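{- Let $n>0$. For every Schröder path $S$ from $(0,0)$ to $(n-1,n-1)$ there is an ADI word $W$ of a DI-sortable permutation of $[n]$ such that $\Phi(W)=S$.
   Context: A permutation $\pi=\pi_1\cdots\pi_n$ of $[n]$ is processed by a machine consisting of an input (initially $\pi_1,\dots,\pi_n$), a first stack, a second stack, and an output, with operations: $\mathsf{E}$ moves the next input entry onto the top of the first stack; $\mathsf{N}$ pops the top of the first stack and pushes it onto the second stack; $\mathsf{C}$ pops the top of the second stack to the output. A DI word of $\pi$ is a word over $\{\mathsf{E},\mathsf{N},\mathsf{C}\}$ whose operations are all legal when applied in order starting from $\pi$ in the input and empty stacks, whose final output is $12\cdots n$, and during which the first stack's entries always decrease from top to bottom and the second stack's entries always increase from top to bottom; $\pi$ is DI-sortable if it has a DI word. The ADI word of a DI-sortable $\pi$ is the word of operations performed by the following algorithm, which at each stage performs the first applicable step: (1) if the top entry of the second stack is the smallest value not yet output, perform $\mathsf{C}$; (2) if the first stack is nonempty and its $m$ entries are exactly the next $m$ values to be output, transfer all of them to the second stack by $m$ successive $\mathsf{N}$ operations; (3) otherwise, if the next input entry is smaller than the top of the second stack and larger than the top of the first stack (each comparison counting as satisfied if the corresponding stack is empty), perform $\mathsf{E}$; (4) otherwise perform $\mathsf{N}$. In an ADI word, every maximal block of consecutive $\mathsf{C}$'s is immediately preceded by $\mathsf{E}\mathsf{N}$. The map $\Phi$: given an ADI word $W$ with $k$ maximal blocks of consecutive $\mathsf{C}$'s of lengths $\tau_1,\dots,\tau_k$ (in order), set $\ell_i=\tau_1+\cdots+\tau_i$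 (so $\ell_k=n$). Form $T$ by replacing each substring $\mathsf{E}\mathsf{N}\mathsf{C}^{\tau_i}$ (a maximal block of $\mathsf{C}$'s together with the two letters preceding it) by a single $\mathsf{N}$. Form $S_{\mathsf{D}}$ from $T$ by replacing, for each $i\in[k]$, the $\ell_i$-th $\mathsf{N}$ of $T$ by $\mathsf{D}$; delete the final letter (a $\mathsf{D}$) of $S_{\mathsf{D}}$ to obtain $\Phi(W)$. A Schröder path from $(0,0)$ to $(m,m)$ is a word over $\{\mathsf{E},\mathsf{N},\mathsf{D}\}$ read as a lattice path with steps $\mathsf{E}=(1,0)$, $\mathsf{N}=(0,1)$, $\mathsf{D}=(1,1)$, starting at $(0,0)$, ending at $(m,m)$, and staying weakly below the line $y=x$ (for $m=0$, the empty path). -}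

module Defs where

open import Data.Nat.Base using (ℕ; zero; suc; _+_; _<_; _≤_; _>_; _<ᵇ_; _≡ᵇ_)
open import Data.Bool.Base using (Bool; true; false; _∧_; _∨_; not; if_then_else_)
open import Data.List.Base using (List; []; _∷_; _++_; [_]; map; filter; take; length; upTo; filterᵇ)
open import Data.Bool.ListAction using (all; any)
open import Data.List.Relation.Unary.Linked using (Linked)
open import Data.Maybe.Base using (Maybe; just; nothing)
open import Data.Product.Base using (Σ; _×_; _,_; ∃)
open import Relation.Binary.PropositionalEquality using (_≡_)

-- Letters: machine operations E, N, C and Schröder steps E, N, D share
-- one alphabet (E and N play both roles, as in the paper).

data Letter : Set where
  E N C D : Letter

oneTo : ℕ → List ℕ
oneTo n = map suc (upTo n)

-- Machine states.  Stacks are lists whose head is the top entry;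
-- the output is listed in the order it was produced.

record State : Set where
  constructor ⟨_,_,_,_⟩
  field
    input  : List ℕ
    stack1 : List ℕ
    stack2 : List ℕ
    output : List ℕ
open State public

initState : List ℕ → State
initState π = ⟨ π , [] , [] , [] ⟩

apply : Letter → State → Maybe State
apply E ⟨ x ∷ xs , s1 , s2 , o ⟩ = just ⟨ xs , x ∷ s1 , s2 , o ⟩
apply N ⟨ i , x ∷ s1 , s2 , o ⟩ = just ⟨ i , s1 , x ∷ s2 , o ⟩
apply C ⟨ i , s1 , x ∷ s2 , o ⟩ = just ⟨ i , s1 , s2 , o ++ [ x ] ⟩
apply _ _ = nothing

StackOK : State → Set
StackOK s = Linked _>_ (stack1 s) × Linked _<_ (stack2 s)

data Exec : State → List Letter → State → Set where
  stop : ∀ {s} → Exec s [] s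
  step : ∀ {s s' t o w} → apply o s ≡ just s' → StackOK s' →
         Exec s' w t → Exec s (o ∷ w) t

DIWord : ℕ → List ℕ → List Letter → Set
DIWord n π W = Σ State λ t → Exec (initState π) W t × output t ≡ oneTo n

DISortable : ℕ → List ℕ → Set
DISortable n π = ∃ λ W → DIWord n π W

_∈ᵇ_ : ℕ → List ℕ → Bool
x ∈ᵇ ys = any (x ≡ᵇ_) ys

remaining : ℕ → List ℕ → List ℕ
remaining n o = filterᵇ (λ v → not (v ∈ᵇ o)) (oneTo n)

sameSet : List ℕ → List ℕ → Bool
sameSet xs ys = all (_∈ᵇ ys) xs ∧ all (_∈ᵇ xs) ys

rule1 : ℕ → State → Bool
rule1 n s with stack2 s | remaining n (output s)
... | x ∷ _ | y ∷ _ = x ≡ᵇ y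
... | _ | _ = false

rule2 : ℕ → State → Bool
rule2 n s with stack1 s
... | [] = false
... | s1@(_ ∷ _) = sameSet s1 (take (length s1) (remaining n (output s)))

belowTop : ℕ → List ℕ → Bool
belowTop x [] = true
belowTop x (t ∷ _) = x <ᵇ t

aboveTop : ℕ → List ℕ → Bool
aboveTop x [] = true
aboveTop x (t ∷ _) = t <ᵇ x

rule3 : State → Bool
rule3 s with input s
... | [] = false
... | x ∷ _ = belowTop x (stack2 s) ∧ aboveTop x (stack1 s)

-- Step (2) ("m successive N's") is performed
-- one N at a time: after each N the condition of (2) holds again for the
-- remaining m-1 entries and (1) cannot fire in between unless m = 1,
-- so the produced word is the same.
adiChoice : ℕ → State → Letter
adiChoice n s =
  if rule1 n s then C else
  if rule2 n s then N else
  if rule3 s then E else N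

adiStep : ℕ → State → Maybe (Letter × State)
adiStep n s with apply (adiChoice n s) s
... | just s' = just (adiChoice n s , s')
... | nothing = nothing

data ADIRun (n : ℕ) : State → List Letter → Set where
  finish : ∀ {o} → ADIRun n ⟨ [] , [] , [] , o ⟩ []
  go     : ∀ {s s' l w} → adiStep n s ≡ just (l , s') →
           ADIRun n s' w → ADIRun n s (l ∷ w)

ADIWord : ℕ → List ℕ → List Letter → Set
ADIWord n π W = ADIRun n (initState π) W

-- comp W = (T , [τ₁,…,τₖ]) : each E N C^τ (maximal C-block with the
-- two preceding letters) is replaced by a single N.
mutual
  comp : List Letter → List Letter × List ℕ
  comp (E ∷ N ∷ C ∷ rest) = cblock 1 rest
  comp (x ∷ rest) with comp rest
  ... | t , ts = x ∷ t , ts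
  comp [] = [] , []

  cblock : ℕ → List Letter → List Letter × List ℕ
  cblock k (C ∷ rest) = cblock (suc k) rest
  cblock k rest with comp rest
  ... | t , ts = N ∷ t , k ∷ ts

partialSums : ℕ → List ℕ → List ℕ
partialSums acc [] = []
partialSums acc (t ∷ ts) = (acc + t) ∷ partialSums (acc + t) ts

-- replace the ℓ-th N (1-indexed) by D for every ℓ in the list;
-- c counts the N's seen so far
markD : List ℕ → ℕ → List Letter → List Letter
markD ls c [] = []
markD ls c (N ∷ w) = (if suc c ∈ᵇ ls then D else N) ∷ markD ls (suc c) w
markD ls c (x ∷ w) = x ∷ markD ls c w

dropLast : {A : Set} → List A → List A
dropLast [] = []
dropLast (x ∷ []) = []
dropLast (x ∷ y ∷ xs) = x ∷ dropLast (y ∷ xs)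

Φ : List Letter → List Letter
Φ W with comp W
... | T , τs = dropLast (markD (partialSums 0 τs) 0 T)

data Schröder (m : ℕ) : ℕ → ℕ → List Letter → Set where
  done  : Schröder m m m []
  stepE : ∀ {x y w} → Schröder m (suc x) y w → Schröder m x y (E ∷ w)
  stepN : ∀ {x y w} → suc y ≤ x → Schröder m x (suc y) w → Schröder m x y (N ∷ w)
  stepD : ∀ {x y w} → Schröder m (suc x) (suc y) w → Schröder m x y (D ∷ w)

SchröderPath : ℕ → List Letter → Set
SchröderPath m w = Schröder m 0 0 w

module Submission where

-- Write U = S D, a path to (n,n) ending in a diagonal step.  The word W is
-- built from U letter by letter: an E of U is an E of W, and an up-step
-- (N or D) of U becomes an N of W, except when the first stack is empty, in
-- which case it becomes a block E N C^τ.  The block lengths τ are dictated by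
-- the D's of U: the i-th block has length "number of up-steps after the
-- (i-1)-th D up to and including the i-th D".  Compressing the blocks of W
-- back to N's therefore returns U with its D's erased, and the partial sums of
-- the τ's mark exactly the D's, so Φ(W) = S.

open import Defs
open import Data.Bool.Base using (Bool; true; false; T; _∧_; _∨_; not)
open import Data.Bool.Properties using (T-≡; ∧-zeroʳ)
open import Data.Empty using (⊥; ⊥-elim)
open import Data.List.Base using (List; []; _∷_; _++_; [_]; length; replicate; map; upTo; filterᵇ)
open import Data.List.Properties
  using (filter-++; filter-all; filter-none; ++-assoc; ++-identityʳ; length-++; map-++; applyUpTo-∷ʳ)
open import Data.List.Membership.Propositional using (_∈_)
open import Data.List.Relation.Unary.All as All using (All; []; _∷_)
open import Data.List.Relation.Unary.All.Properties using (++⁺)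
import Data.List.Relation.Unary.Any as Any
open import Data.List.Relation.Unary.Any.Properties using (any⁺)
open import Data.List.Relation.Unary.Linked as Linked using (Linked; []; [-]; _∷_)
open import Data.List.Relation.Binary.Permutation.Propositional
  using (_↭_; ↭-trans; ↭-sym; ↭-reflexive)
open import Data.List.Relation.Binary.Permutation.Propositional.Properties using (shift; ++⁺ˡ; ∷↭∷ʳ)
open import Data.Maybe.Base using (just)
open import Data.Nat.Base using (ℕ; zero; suc; _+_; _∸_; _≤_; _<_; _>_; _≡ᵇ_; z≤n; s≤s)
open import Data.Nat.ListAction using (sum)
open import Data.Nat.ListAction.Properties using (sum-++)
open import Data.Nat.Properties
open import Data.Nat.Tactic.RingSolver using (solve-∀)
open import Data.Product.Base using (Σ; ∃-syntax; _×_; _,_; proj₁; proj₂)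
open import Data.Unit.Base using (⊤; tt)
open import Function.Bundles using (Equivalence)
open import Relation.Binary.PropositionalEquality
  using (_≡_; _≢_; refl; sym; trans; cong; cong₂; subst; module ≡-Reasoning)
open import Relation.Nullary.Negation using (¬_)

¬T⇒false : ∀ {b} → ¬ T b → b ≡ false
¬T⇒false {false} _  = refl
¬T⇒false {true}  ¬t = ⊥-elim (¬t tt)

≡ᵇ-refl : ∀ v → (v ≡ᵇ v) ≡ true
≡ᵇ-refl v = Equivalence.to T-≡ (≡⇒≡ᵇ v v refl)

≡ᵇ-false : ∀ {u v} → u ≢ v → (u ≡ᵇ v) ≡ false
≡ᵇ-false {u} {v} u≢v = ¬T⇒false (λ t → u≢v (≡ᵇ⇒≡ u v t))

∈ᵇ-present : ∀ {v xs} → v ∈ xs → (v ∈ᵇ xs) ≡ true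
∈ᵇ-present {v} v∈xs = Equivalence.to T-≡ (any⁺ (v ≡ᵇ_) (Any.map (≡⇒≡ᵇ v _) v∈xs))

∈ᵇ-absent : ∀ {v} xs → All (v ≢_) xs → (v ∈ᵇ xs) ≡ false
∈ᵇ-absent []       []              = refl
∈ᵇ-absent (x ∷ xs) (v≢x ∷ v∉xs) rewrite ≡ᵇ-false v≢x = ∈ᵇ-absent xs v∉xs

interval : ℕ → ℕ → List ℕ
interval a zero    = []
interval a (suc k) = a ∷ interval (suc a) k

interval-++ : ∀ a j k → interval a (j + k) ≡ interval a j ++ interval (a + j) k
interval-++ a zero    k rewrite +-identityʳ a = refl
interval-++ a (suc j) k rewrite +-suc a j = cong (a ∷_) (interval-++ (suc a) j k)

interval-snoc : ∀ a k → interval a k ++ [ a + k ] ≡ interval a (suc k)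
interval-snoc a k = trans (sym (interval-++ a k 1)) (cong (interval a) (+-comm k 1))

length-interval : ∀ a k → length (interval a k) ≡ k
length-interval a zero    = refl
length-interval a (suc k) = cong suc (length-interval (suc a) k)

interval-lower : ∀ a k → All (a ≤_) (interval a k)
interval-lower a zero    = []
interval-lower a (suc k) = ≤-refl ∷ All.map <⇒≤ (interval-lower (suc a) k)

interval-upper : ∀ a k → All (_< a + k) (interval a k)
interval-upper a zero    = []
interval-upper a (suc k) rewrite +-suc a k = s≤s (m≤m+n a k) ∷ interval-upper (suc a) k

interval-linked : ∀ a k {s} → Linked _<_ s → All (a + k ≤_) s → Linked _<_ (interval a k ++ s)
interval-linked a zero          inc _ = inc
interval-linked a (suc zero)    {[]}    _   _ = [-]
interval-linked a (suc zero)    {v ∷ _} inc (a+1≤v ∷ _) = subst (_≤ v) (+-comm a 1) a+1≤v ∷ inc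
interval-linked a (suc (suc k)) {s} inc above =
  ≤-refl ∷ interval-linked (suc a) (suc k) inc (subst (λ z → All (z ≤_) s) (+-suc a (suc k)) above)

oneTo≡interval : ∀ n → oneTo n ≡ interval 1 n
oneTo≡interval zero    = refl
oneTo≡interval (suc n) = begin
    map suc (upTo (suc n))
  ≡⟨ cong (map suc) (sym (applyUpTo-∷ʳ (λ i → i) n)) ⟩
    map suc (upTo n ++ [ n ])
  ≡⟨ map-++ suc (upTo n) [ n ] ⟩
    oneTo n ++ [ suc n ]
  ≡⟨ cong (_++ [ suc n ]) (oneTo≡interval n) ⟩
    interval 1 n ++ [ 1 + n ]
  ≡⟨ interval-snoc 1 n ⟩
    interval 1 (suc n) ∎
  where open ≡-Reasoning

remaining-interval : ∀ ℓ k → remaining (ℓ + k) (interval 1 ℓ) ≡ interval (suc ℓ) k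
remaining-interval ℓ k = begin
    filterᵇ notOut (oneTo (ℓ + k))
  ≡⟨ cong (filterᵇ notOut) (trans (oneTo≡interval (ℓ + k)) (interval-++ 1 ℓ k)) ⟩
    filterᵇ notOut (interval 1 ℓ ++ interval (suc ℓ) k)
  ≡⟨ filter-++ _ (interval 1 ℓ) (interval (suc ℓ) k) ⟩
    filterᵇ notOut (interval 1 ℓ) ++ filterᵇ notOut (interval (suc ℓ) k)
  ≡⟨ cong₂ _++_ (filter-none _ (All.tabulate isOut)) (filter-all _ (All.map isPending (interval-lower (suc ℓ) k))) ⟩
    interval (suc ℓ) k ∎
  where
  open ≡-Reasoning
  notOut : ℕ → Bool
  notOut v = not (v ∈ᵇ interval 1 ℓ)
  isOut : ∀ {v} → v ∈ interval 1 ℓ → ¬ T (notOut v)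
  isOut v∈ rewrite ∈ᵇ-present v∈ = λ ()
  isPending : ∀ {v} → suc ℓ ≤ v → T (notOut v)
  isPending ℓ<v rewrite ∈ᵇ-absent (interval 1 ℓ)
    (All.map (λ u<ℓ+1 v≡u → <-irrefl (sym v≡u) (<-≤-trans u<ℓ+1 ℓ<v)) (interval-upper 1 ℓ)) = tt

remaining-next : ∀ {ℓ n} → ℓ < n → ∃[ rest ] remaining n (interval 1 ℓ) ≡ suc ℓ ∷ rest
remaining-next {ℓ} {n} ℓ<n = interval (suc (suc ℓ)) k , (begin
    remaining n (interval 1 ℓ)
  ≡⟨ cong (λ z → remaining z (interval 1 ℓ)) (sym ℓ+k+1≡n) ⟩
    remaining (ℓ + suc k) (interval 1 ℓ)
  ≡⟨ remaining-interval ℓ (suc k) ⟩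
    interval (suc ℓ) (suc k) ∎)
  where
  open ≡-Reasoning
  k = n ∸ suc ℓ
  ℓ+k+1≡n : ℓ + suc k ≡ n
  ℓ+k+1≡n = trans (+-suc ℓ k) (m+[n∸m]≡n ℓ<n)

-- The ADI algorithm on configurations whose output is 1,…,ℓ

config : List ℕ → List ℕ → List ℕ → ℕ → State
config i s₁ s₂ ℓ = ⟨ i , s₁ , s₂ , interval 1 ℓ ⟩

final : ℕ → State
final n = config [] [] [] n

rule1-no : ∀ {n ℓ i s₁ s₂} → ℓ < n → All (suc ℓ <_) s₂ → rule1 n (config i s₁ s₂ ℓ) ≡ false
rule1-no {s₂ = []}    _   _ = refl
rule1-no {s₂ = a ∷ _} ℓ<n (ℓ+1<a ∷ _) with remaining-next ℓ<n
... | _ , eq rewrite eq = ≡ᵇ-false (λ a≡ → <-irrefl (sym a≡) ℓ+1<a)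

rule1-yes : ∀ {n ℓ i s₁ s₂} → ℓ < n → rule1 n (config i s₁ (suc ℓ ∷ s₂) ℓ) ≡ true
rule1-yes {ℓ = ℓ} ℓ<n with remaining-next ℓ<n
... | _ , eq rewrite eq = ≡ᵇ-refl (suc ℓ)

rule2-no : ∀ {n ℓ i s₁ s₂} → ℓ < n → All (suc ℓ <_) s₁ → rule2 n (config i s₁ s₂ ℓ) ≡ false
rule2-no {s₁ = []}     _   _     = refl
rule2-no {s₁ = a ∷ s₁} ℓ<n above with remaining-next ℓ<n
... | _ , eq rewrite eq | ∈ᵇ-absent (a ∷ s₁) (All.map (λ ℓ+1<u e → <-irrefl e ℓ+1<u) above) = ∧-zeroʳ _

rule2-yes : ∀ {n ℓ i s₂} → ℓ < n → rule2 n (config i [ suc ℓ ] s₂ ℓ) ≡ true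
rule2-yes {ℓ = ℓ} ℓ<n with remaining-next ℓ<n
... | _ , eq rewrite eq | ≡ᵇ-refl ℓ = refl

TopsOrdered : List ℕ → List ℕ → Set
TopsOrdered (a ∷ _) (b ∷ _) = a < b
TopsOrdered _       _       = ⊤

belowTop-true : ∀ {x s} → TopsOrdered [ x ] s → belowTop x s ≡ true
belowTop-true {s = []}    _   = refl
belowTop-true {s = _ ∷ _} x<t = Equivalence.to T-≡ (<⇒<ᵇ x<t)

aboveTop-true : ∀ {x s} → Linked _>_ (x ∷ s) → aboveTop x s ≡ true
aboveTop-true {s = []}    _         = refl
aboveTop-true {s = _ ∷ _} (t<x ∷ _) = Equivalence.to T-≡ (<⇒<ᵇ t<x)

aboveTop-false : ∀ {x t s} → x ≤ t → aboveTop x (t ∷ s) ≡ false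
aboveTop-false {x} {t} x≤t = ¬T⇒false (λ t<ᵇx → ≤⇒≯ x≤t (<ᵇ⇒< t x t<ᵇx))

choose-C : ∀ {n s} → rule1 n s ≡ true → adiChoice n s ≡ C
choose-C r1 rewrite r1 = refl

choose-N-by-rule2 : ∀ {n s} → rule1 n s ≡ false → rule2 n s ≡ true → adiChoice n s ≡ N
choose-N-by-rule2 r1 r2 rewrite r1 | r2 = refl

choose-N-by-rule4 : ∀ {n s} → rule1 n s ≡ false → rule3 s ≡ false → adiChoice n s ≡ N
choose-N-by-rule4 {n} {s} r1 r3 rewrite r1 | r3 with rule2 n s
... | true  = refl
... | false = refl

choose-E : ∀ {n s} → rule1 n s ≡ false → rule2 n s ≡ false → rule3 s ≡ true → adiChoice n s ≡ E
choose-E r1 r2 r3 rewrite r1 | r2 | r3 = refl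

adiStep-performs : ∀ {n s l s'} → adiChoice n s ≡ l → apply l s ≡ just s' → adiStep n s ≡ just (l , s')
adiStep-performs refl legal rewrite legal = refl

-- Tails of ADI runs, and extending them backwards

data NextInput (ℓ : ℕ) (s₂ : List ℕ) : List ℕ → Set where
  exhausted : NextInput ℓ s₂ []
  next      : ∀ {i} → NextInput ℓ s₂ (suc ℓ ∷ i)
  below     : ∀ {y i} → TopsOrdered [ y ] s₂ → NextInput ℓ s₂ (y ∷ i)

record Stacks (ℓ : ℕ) (s₁ s₂ : List ℕ) : Set where
  field
    decreasing₁ : Linked _>_ s₁
    increasing₂ : Linked _<_ s₂
    pending₁    : All (suc ℓ <_) s₁
    pending₂    : All (suc ℓ <_) s₂
    topsOrdered : TopsOrdered s₁ s₂

record ADITail (n ℓ : ℕ) (i s₁ s₂ : List ℕ) (w : List Letter) : Set where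
  field
    stacks    : Stacks ℓ s₁ s₂
    nextInput : NextInput ℓ s₂ i
    exec      : Exec (config i s₁ s₂ ℓ) w (final n)
    adi       : ADIRun n (config i s₁ s₂ ℓ) w

tops-after-E : ∀ {b s₁ s₂} → Linked _>_ (b ∷ s₁) → TopsOrdered (b ∷ s₁) s₂ → TopsOrdered s₁ s₂
tops-after-E {s₁ = []}                   _         _   = tt
tops-after-E {s₁ = _ ∷ _} {s₂ = []}      _         _   = tt
tops-after-E {s₁ = _ ∷ _} {s₂ = _ ∷ _}   (c<b ∷ _) b<d = <-trans c<b b<d

top-only : ∀ {b s₁ s₂} → TopsOrdered (b ∷ s₁) s₂ → TopsOrdered [ b ] s₂
top-only {s₂ = []}    _   = tt
top-only {s₂ = _ ∷ _} b<d = b<d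

tops-after-N : ∀ {a s₁ s₂} → Linked _<_ (a ∷ s₂) → TopsOrdered (a ∷ s₁) s₂
tops-after-N {s₂ = []}    _         = tt
tops-after-N {s₂ = _ ∷ _} (a<d ∷ _) = a<d

push-larger : ∀ {a s₁ s₂} → TopsOrdered s₁ (a ∷ s₂) → Linked _>_ s₁ → Linked _>_ (a ∷ s₁)
push-larger {s₁ = []}    _   _   = [-]
push-larger {s₁ = _ ∷ _} c<a dec = c<a ∷ dec

nextInput-after-N : ∀ {ℓ a s₂ i} → Linked _<_ (a ∷ s₂) → NextInput ℓ (a ∷ s₂) i → NextInput ℓ s₂ i
nextInput-after-N                _         exhausted   = exhausted
nextInput-after-N                _         next        = next
nextInput-after-N {s₂ = []}      _         (below _)   = below tt
nextInput-after-N {s₂ = _ ∷ _}   (a<d ∷ _) (below y<a) = below (<-trans y<a a<d)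

rule3-no : ∀ {ℓ i a s₁ s₂} → suc ℓ < a → NextInput ℓ (a ∷ s₂) i → rule3 (config i (a ∷ s₁) s₂ ℓ) ≡ false
rule3-no                 _     exhausted   = refl
rule3-no {s₁ = s₁} ℓ+1<a next        rewrite aboveTop-false {s = s₁} (<⇒≤ ℓ+1<a) = ∧-zeroʳ _
rule3-no {s₁ = s₁} _     (below y<a) rewrite aboveTop-false {s = s₁} (<⇒≤ y<a)   = ∧-zeroʳ _

push-E : ∀ {n ℓ i b s₁ s₂ w} → ℓ < n → ADITail n ℓ i (b ∷ s₁) s₂ w → ADITail n ℓ (b ∷ i) s₁ s₂ (E ∷ w)
push-E {n} {ℓ} {i} {b} {s₁} {s₂} ℓ<n tl = record
  { stacks    = record
    { decreasing₁ = Linked.tail decreasing₁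
    ; increasing₂ = increasing₂
    ; pending₁    = All.tail pending₁
    ; pending₂    = pending₂
    ; topsOrdered = tops-after-E decreasing₁ topsOrdered }
  ; nextInput = below (top-only topsOrdered)
  ; exec      = step refl (decreasing₁ , increasing₂) exec
  ; adi       = go (adiStep-performs chooses-E refl) adi }
  where
  open ADITail tl
  open Stacks stacks
  chooses-E : adiChoice n (config (b ∷ i) s₁ s₂ ℓ) ≡ E
  chooses-E = choose-E {n} {config (b ∷ i) s₁ s₂ ℓ}
    (rule1-no {i = b ∷ i} {s₁} ℓ<n pending₂)
    (rule2-no {i = b ∷ i} {s₂ = s₂} ℓ<n (All.tail pending₁))
    (cong₂ _∧_ (belowTop-true (top-only topsOrdered)) (aboveTop-true decreasing₁))

push-N : ∀ {n ℓ i a s₁ s₂ w} → ℓ < n → ADITail n ℓ i s₁ (a ∷ s₂) w → ADITail n ℓ i (a ∷ s₁) s₂ (N ∷ w)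
push-N {n} {ℓ} {i} {a} {s₁} {s₂} ℓ<n tl = record
  { stacks    = record
    { decreasing₁ = push-larger topsOrdered decreasing₁
    ; increasing₂ = Linked.tail increasing₂
    ; pending₁    = All.head pending₂ ∷ pending₁
    ; pending₂    = All.tail pending₂
    ; topsOrdered = tops-after-N increasing₂ }
  ; nextInput = nextInput-after-N increasing₂ nextInput
  ; exec      = step refl (decreasing₁ , increasing₂) exec
  ; adi       = go (adiStep-performs chooses-N refl) adi }
  where
  open ADITail tl
  open Stacks stacks
  chooses-N : adiChoice n (config i (a ∷ s₁) s₂ ℓ) ≡ N
  chooses-N = choose-N-by-rule4 {n} {config i (a ∷ s₁) s₂ ℓ}
    (rule1-no {i = i} {a ∷ s₁} ℓ<n (All.tail pending₂))
    (rule3-no (All.head pending₂) nextInput)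

Sorts : ℕ → State → List Letter → Set
Sorts n s w = Exec s w (final n) × ADIRun n s w

drain : ∀ {n i s₂ w} k ℓ {ℓ'} → ℓ + k ≡ ℓ' → ℓ' ≤ n → Linked _<_ s₂ → All (ℓ' <_) s₂ →
        Sorts n (config i [] s₂ ℓ') w → Sorts n (config i [] (interval (suc ℓ) k ++ s₂) ℓ) (replicate k C ++ w)
drain {n} {i} {s₂} {w} zero ℓ ℓ+0≡ℓ' _ _ _ sorts =
  subst (λ z → Sorts n (config i [] s₂ z) w) (trans (sym ℓ+0≡ℓ') (+-identityʳ ℓ)) sorts
drain {n} {i} {s₂} {w} (suc k) ℓ {ℓ'} ℓ+k+1≡ℓ' ℓ'≤n inc above sorts =
  step pop ([] , linked) (proj₁ rest) ,
  go (adiStep-performs chooses-C pop) (proj₂ rest)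
  where
  ℓ+1+k≡ℓ' : suc ℓ + k ≡ ℓ'
  ℓ+1+k≡ℓ' = trans (sym (+-suc ℓ k)) ℓ+k+1≡ℓ'
  rest : Sorts n (config i [] (interval (suc (suc ℓ)) k ++ s₂) (suc ℓ)) (replicate k C ++ w)
  rest = drain k (suc ℓ) ℓ+1+k≡ℓ' ℓ'≤n inc above sorts
  ℓ<n : ℓ < n
  ℓ<n = ≤-trans (s≤s (m≤m+n ℓ k)) (≤-trans (≤-reflexive ℓ+1+k≡ℓ') ℓ'≤n)
  pop : apply C (config i [] (interval (suc ℓ) (suc k) ++ s₂) ℓ)
      ≡ just (config i [] (interval (suc (suc ℓ)) k ++ s₂) (suc ℓ))
  pop = cong (λ o → just ⟨ i , [] , interval (suc (suc ℓ)) k ++ s₂ , o ⟩) (interval-snoc 1 ℓ)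
  chooses-C : adiChoice n (config i [] (interval (suc ℓ) (suc k) ++ s₂) ℓ) ≡ C
  chooses-C = choose-C {n} {config i [] (interval (suc ℓ) (suc k) ++ s₂) ℓ} (rule1-yes {i = i} {[]} ℓ<n)
  linked : Linked _<_ (interval (suc (suc ℓ)) k ++ s₂)
  linked = interval-linked (suc (suc ℓ)) k inc (subst (λ z → All (suc z ≤_) s₂) (sym ℓ+1+k≡ℓ') above)

push-block : ∀ {n ℓ t i s₂ w} → ℓ + suc t ≤ n → ADITail n (ℓ + suc t) i [] s₂ w →
             ADITail n ℓ (suc ℓ ∷ i) [] (interval (suc (suc ℓ)) t ++ s₂) (E ∷ N ∷ replicate (suc t) C ++ w)
push-block {n} {ℓ} {t} {i} {s₂} {w} bound tl = record
  { stacks    = record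
    { decreasing₁ = []
    ; increasing₂ = Linked.tail linked
    ; pending₁    = []
    ; pending₂    = pending
    ; topsOrdered = tt }
  ; nextInput = next
  ; exec      = step refl ([-] , Linked.tail linked) (step refl ([] , linked) (proj₁ drained))
  ; adi       = go (adiStep-performs reads-ℓ+1 refl) (go (adiStep-performs moves-ℓ+1 refl) (proj₂ drained)) }
  where
  open ADITail tl
  open Stacks stacks
  M = interval (suc (suc ℓ)) t ++ s₂
  ℓ<n : ℓ < n
  ℓ<n = <-≤-trans (m<m+n ℓ (s≤s z≤n)) bound
  linked : Linked _<_ (interval (suc ℓ) (suc t) ++ s₂)
  linked = interval-linked (suc ℓ) (suc t) increasing₂ (All.map <⇒≤ pending₂)
  pending : All (suc ℓ <_) M
  pending = ++⁺ (interval-lower (suc (suc ℓ)) t) (All.map (≤-trans (s≤s (s≤s (m≤m+n ℓ (suc t))))) pending₂)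
  reads-ℓ+1 : adiChoice n (config (suc ℓ ∷ i) [] M ℓ) ≡ E
  reads-ℓ+1 = choose-E {n} {config (suc ℓ ∷ i) [] M ℓ}
    (rule1-no {i = suc ℓ ∷ i} {[]} ℓ<n pending)
    refl
    (cong₂ _∧_ (belowTop-true (tops-after-N {s₁ = []} linked)) refl)
  moves-ℓ+1 : adiChoice n (config i [ suc ℓ ] M ℓ) ≡ N
  moves-ℓ+1 = choose-N-by-rule2 {n} {config i [ suc ℓ ] M ℓ}
    (rule1-no {i = i} {[ suc ℓ ]} ℓ<n pending)
    (rule2-yes {i = i} {M} ℓ<n)
  drained : Sorts n (config i [] (interval (suc ℓ) (suc t) ++ s₂) ℓ) (replicate (suc t) C ++ w)
  drained = drain (suc t) ℓ refl bound increasing₂ (All.map <⇒≤ pending₂) (exec , adi)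

contents : State → List ℕ
contents ⟨ i , s₁ , s₂ , o ⟩ = i ++ s₁ ++ s₂ ++ o

apply-↭ : ∀ o s {s'} → apply o s ≡ just s' → contents s ↭ contents s'
apply-↭ E ⟨ x ∷ i , s₁ , s₂ , o ⟩ refl = ↭-sym (shift x i (s₁ ++ s₂ ++ o))
apply-↭ N ⟨ i , x ∷ s₁ , s₂ , o ⟩ refl = ++⁺ˡ i (↭-sym (shift x s₁ (s₂ ++ o)))
apply-↭ C ⟨ i , s₁ , x ∷ s₂ , o ⟩ refl =
  ++⁺ˡ i (++⁺ˡ s₁ (↭-trans (∷↭∷ʳ x (s₂ ++ o)) (↭-reflexive (++-assoc s₂ o [ x ]))))
apply-↭ E ⟨ [] , _ , _ , _ ⟩ ()
apply-↭ N ⟨ _ , [] , _ , _ ⟩ ()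
apply-↭ C ⟨ _ , _ , [] , _ ⟩ ()
apply-↭ D _ ()

exec-↭ : ∀ {s w t} → Exec s w t → contents s ↭ contents t
exec-↭ stop            = ↭-reflexive refl
exec-↭ (step legal _ ex) = ↭-trans (apply-↭ _ _ legal) (exec-↭ ex)

sorted-permutation : ∀ {n π w} → Exec (initState π) w (final n) → π ↭ oneTo n
sorted-permutation {n} {π} ex =
  ↭-trans (↭-reflexive (sym (++-identityʳ π))) (↭-trans (exec-↭ ex) (↭-reflexive (sym (oneTo≡interval n))))

-- Words as token lists, and the compression step of Φ

-- block t stands for the factor E N C^(t+1) of a word.
data Token : Set where
  letE letN : Token
  block     : ℕ → Token

flatten : List Token → List Letter
flatten []            = []
flatten (letE ∷ ts)    = E ∷ flatten ts
flatten (letN ∷ ts)    = N ∷ flatten ts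
flatten (block t ∷ ts) = E ∷ N ∷ replicate (suc t) C ++ flatten ts

skeleton : List Token → List Letter
skeleton []            = []
skeleton (letE ∷ ts)    = E ∷ skeleton ts
skeleton (letN ∷ ts)    = N ∷ skeleton ts
skeleton (block _ ∷ ts) = N ∷ skeleton ts

blockLengths : List Token → List ℕ
blockLengths []            = []
blockLengths (letE ∷ ts)    = blockLengths ts
blockLengths (letN ∷ ts)    = blockLengths ts
blockLengths (block t ∷ ts) = suc t ∷ blockLengths ts

NoLeadingC : List Letter → Set
NoLeadingC (C ∷ _) = ⊥
NoLeadingC _       = ⊤

NoLeadingNC : List Letter → Set
NoLeadingNC (N ∷ w) = NoLeadingC w
NoLeadingNC _       = ⊤

flatten-noC : ∀ ts → NoLeadingC (flatten ts)
flatten-noC []            = tt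
flatten-noC (letE ∷ _)    = tt
flatten-noC (letN ∷ _)    = tt
flatten-noC (block _ ∷ _) = tt

flatten-noNC : ∀ ts → NoLeadingNC (flatten ts)
flatten-noNC []            = tt
flatten-noNC (letE ∷ _)    = tt
flatten-noNC (letN ∷ ts)   = flatten-noC ts
flatten-noNC (block _ ∷ _) = tt

comp-E : ∀ w → NoLeadingNC w → comp (E ∷ w) ≡ (E ∷ proj₁ (comp w) , proj₂ (comp w))
comp-E []           _ = refl
comp-E (E ∷ _)      _ = refl
comp-E (C ∷ _)      _ = refl
comp-E (D ∷ _)      _ = refl
comp-E (N ∷ [])     _ = refl
comp-E (N ∷ E ∷ _)  _ = refl
comp-E (N ∷ N ∷ _)  _ = refl
comp-E (N ∷ D ∷ _)  _ = refl
comp-E (N ∷ C ∷ _)  ()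

cblock-Cs : ∀ k j w → cblock k (replicate j C ++ w) ≡ cblock (k + j) w
cblock-Cs k zero    w = cong (λ z → cblock z w) (sym (+-identityʳ k))
cblock-Cs k (suc j) w = trans (cblock-Cs (suc k) j w) (cong (λ z → cblock z w) (sym (+-suc k j)))

cblock-end : ∀ k w → NoLeadingC w → cblock k w ≡ (N ∷ proj₁ (comp w) , k ∷ proj₂ (comp w))
cblock-end k []      _ = refl
cblock-end k (E ∷ _) _ = refl
cblock-end k (N ∷ _) _ = refl
cblock-end k (D ∷ _) _ = refl
cblock-end k (C ∷ _) ()

comp-flatten : ∀ ts → comp (flatten ts) ≡ (skeleton ts , blockLengths ts)
comp-flatten []             = refl
comp-flatten (letE ∷ ts)
  rewrite comp-E (flatten ts) (flatten-noNC ts) | comp-flatten ts = refl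
comp-flatten (letN ∷ ts)
  rewrite comp-flatten ts = refl
comp-flatten (block t ∷ ts)
  rewrite cblock-Cs 1 t (flatten ts) | cblock-end (suc t) (flatten ts) (flatten-noC ts) | comp-flatten ts = refl

Φ-flatten : ∀ ts → Φ (flatten ts) ≡ dropLast (markD (partialSums 0 (blockLengths ts)) 0 (skeleton ts))
Φ-flatten ts rewrite comp-flatten ts = refl

data Up : Letter → Set where
  up-N : Up N
  up-D : Up D

erase : List Letter → List Letter
erase []      = []
erase (D ∷ U) = N ∷ erase U
erase (x ∷ U) = x ∷ erase U

erase-up : ∀ {l U} → Up l → erase (l ∷ U) ≡ N ∷ erase U
erase-up up-N = refl
erase-up up-D = refl

prescribed : ℕ → List Letter → List ℕ
prescribed c []      = []
prescribed c (D ∷ U) = suc c ∷ prescribed 0 U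
prescribed c (N ∷ U) = prescribed (suc c) U
prescribed c (E ∷ U) = prescribed c U
prescribed c (C ∷ U) = prescribed c U

dPositions : ℕ → List Letter → List ℕ
dPositions c []      = []
dPositions c (D ∷ U) = suc c ∷ dPositions (suc c) U
dPositions c (N ∷ U) = dPositions (suc c) U
dPositions c (E ∷ U) = dPositions c U
dPositions c (C ∷ U) = dPositions c U

dPositions-above : ∀ c U → All (c <_) (dPositions c U)
dPositions-above c []      = []
dPositions-above c (D ∷ U) = ≤-refl ∷ All.map (<-trans (n<1+n c)) (dPositions-above (suc c) U)
dPositions-above c (N ∷ U) = All.map (<-trans (n<1+n c)) (dPositions-above (suc c) U)
dPositions-above c (E ∷ U) = dPositions-above c U
dPositions-above c (C ∷ U) = dPositions-above c U

partialSums-prescribed : ∀ a c U → partialSums a (prescribed c U) ≡ dPositions (a + c) U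
partialSums-prescribed a c []      = refl
partialSums-prescribed a c (D ∷ U)
  rewrite partialSums-prescribed (a + suc c) 0 U | +-identityʳ (a + suc c) | +-suc a c = refl
partialSums-prescribed a c (N ∷ U) rewrite partialSums-prescribed a (suc c) U | +-suc a c = refl
partialSums-prescribed a c (E ∷ U) = partialSums-prescribed a c U
partialSums-prescribed a c (C ∷ U) = partialSums-prescribed a c U

-- Marking the N's of erase U at the positions of its D's restores U; the list
-- of marks only has to agree with those positions beyond the current count c.
markD-erase : ∀ ls c U → (∀ j → c < j → (j ∈ᵇ ls) ≡ (j ∈ᵇ dPositions c U)) → markD ls c (erase U) ≡ U
markD-erase ls c []      _    = refl
markD-erase ls c (E ∷ U) agree = cong (E ∷_) (markD-erase ls c U agree)
markD-erase ls c (C ∷ U) agree = cong (C ∷_) (markD-erase ls c U agree)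
markD-erase ls c (N ∷ U) agree
  rewrite agree (suc c) ≤-refl
        | ∈ᵇ-absent (dPositions (suc c) U) (All.map (λ c+1<u e → <-irrefl e c+1<u) (dPositions-above (suc c) U)) =
  cong (N ∷_) (markD-erase ls (suc c) U (λ j c+1<j → agree j (<-trans (n<1+n c) c+1<j)))
markD-erase ls c (D ∷ U) agree rewrite agree (suc c) ≤-refl | ≡ᵇ-refl c =
  cong (D ∷_) (markD-erase ls (suc c) U agree′)
  where
  agree′ : ∀ j → suc c < j → (j ∈ᵇ ls) ≡ (j ∈ᵇ dPositions (suc c) U)
  agree′ j c+1<j = trans (agree j (<-trans (n<1+n c) c+1<j))
    (cong (_∨ (j ∈ᵇ dPositions (suc c) U)) (≡ᵇ-false (λ e → <-irrefl (sym e) c+1<j)))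

dropLast-snoc : ∀ (S : List Letter) x → dropLast (S ++ [ x ]) ≡ S
dropLast-snoc []          x = refl
dropLast-snoc (a ∷ [])    x = refl
dropLast-snoc (a ∷ b ∷ S) x = cong (a ∷_) (dropLast-snoc (b ∷ S) x)

Φ-recovers : ∀ S ts → skeleton ts ≡ erase (S ++ [ D ]) → blockLengths ts ≡ prescribed 0 (S ++ [ D ]) →
             Φ (flatten ts) ≡ S
Φ-recovers S ts skel lens = begin
    Φ (flatten ts)
  ≡⟨ Φ-flatten ts ⟩
    dropLast (markD (partialSums 0 (blockLengths ts)) 0 (skeleton ts))
  ≡⟨ cong₂ (λ ls T → dropLast (markD ls 0 T)) (trans (cong (partialSums 0) lens) (partialSums-prescribed 0 0 U)) skel ⟩
    dropLast (markD (dPositions 0 U) 0 (erase U))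
  ≡⟨ cong dropLast (markD-erase (dPositions 0 U) 0 U (λ _ _ → refl)) ⟩
    dropLast U
  ≡⟨ dropLast-snoc S D ⟩
    S ∎
  where
  open ≡-Reasoning
  U = S ++ [ D ]

-- Words built so far, extended backwards one letter of the path at a time

record Built (n ℓ h σ : ℕ) (q : List ℕ) (U : List Letter) : Set where
  field
    tokens    : List Token
    queue     : List ℕ
    stack₁    : List ℕ
    stack₂    : List ℕ
    skeleton≡ : skeleton tokens ≡ erase U
    lengths≡  : blockLengths tokens ≡ q
    height    : length stack₁ ≡ h
    depth     : length stack₂ ≡ σ
    finishes  : ADITail n ℓ queue stack₁ stack₂ (flatten tokens)

terminal : ∀ {n} → Built n n 0 0 [] []
terminal = record
  { tokens = [] ; queue = [] ; stack₁ = [] ; stack₂ = []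
  ; skeleton≡ = refl ; lengths≡ = refl ; height = refl ; depth = refl
  ; finishes = record
    { stacks    = record { decreasing₁ = [] ; increasing₂ = [] ; pending₁ = [] ; pending₂ = [] ; topsOrdered = tt }
    ; nextInput = exhausted
    ; exec      = stop
    ; adi       = finish } }

recast : ∀ {n ℓ h σ σ' q q' U} → σ ≡ σ' → q ≡ q' → Built n ℓ h σ q U → Built n ℓ h σ' q' U
recast refl refl b = b

extend-E : ∀ {n ℓ h σ q U} → ℓ < n → Built n ℓ (suc h) σ q U → Built n ℓ h σ q (E ∷ U)
extend-E ℓ<n record { stack₁ = [] ; height = () }
extend-E ℓ<n record { tokens = ts ; queue = i ; stack₁ = b ∷ s₁ ; stack₂ = s₂ ; skeleton≡ = skel
                    ; lengths≡ = lens ; height = ht ; depth = dp ; finishes = tl } = record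
  { tokens = letE ∷ ts ; queue = b ∷ i ; stack₁ = s₁ ; stack₂ = s₂ ; skeleton≡ = cong (E ∷_) skel
  ; lengths≡ = lens ; height = suc-injective ht ; depth = dp ; finishes = push-E ℓ<n tl }

extend-N : ∀ {n ℓ h σ q l U} → Up l → ℓ < n → Built n ℓ h (suc σ) q U → Built n ℓ (suc h) σ q (l ∷ U)
extend-N up ℓ<n record { stack₂ = [] ; depth = () }
extend-N up ℓ<n record { tokens = ts ; queue = i ; stack₁ = s₁ ; stack₂ = a ∷ s₂ ; skeleton≡ = skel
                       ; lengths≡ = lens ; height = ht ; depth = dp ; finishes = tl } = record
  { tokens = letN ∷ ts ; queue = i ; stack₁ = a ∷ s₁ ; stack₂ = s₂ ; skeleton≡ = trans (cong (N ∷_) skel) (sym (erase-up up))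
  ; lengths≡ = lens ; height = cong suc ht ; depth = suc-injective dp ; finishes = push-N ℓ<n tl }

extend-block : ∀ {n ℓ t σ q l U} → Up l → ℓ + suc t ≤ n → Built n (ℓ + suc t) 0 σ q U →
               Built n ℓ 0 (t + σ) (suc t ∷ q) (l ∷ U)
extend-block up bound record { stack₁ = _ ∷ _ ; height = () }
extend-block {ℓ = ℓ} {t} up bound
  record { tokens = ts ; queue = i ; stack₁ = [] ; stack₂ = s₂ ; skeleton≡ = skel
         ; lengths≡ = lens ; height = ht ; depth = dp ; finishes = tl } = record
  { tokens = block t ∷ ts ; queue = suc ℓ ∷ i ; stack₁ = [] ; stack₂ = interval (suc (suc ℓ)) t ++ s₂
  ; skeleton≡ = trans (cong (N ∷_) skel) (sym (erase-up up)) ; lengths≡ = cong (suc t ∷_) lens ; height = refl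
  ; depth = trans (length-++ (interval (suc (suc ℓ)) t)) (cong₂ _+_ (length-interval (suc (suc ℓ)) t) dp)
  ; finishes = push-block bound tl }

-- Ledger x y h ℓ c P: at path position (x , y), with h entries on the first
-- stack and ℓ values output, the D's already read whose blocks are still to
-- come have prescribed lengths P, and c up-steps were read since the last D.
record Ledger (x y h ℓ c : ℕ) (P : List ℕ) : Set where
  field
    positive : All (0 <_) P
    balance  : length P + h + y ≡ x
    count    : sum P + c + ℓ ≡ y

start : Ledger 0 0 0 0 0 []
start = record { positive = [] ; balance = refl ; count = refl }

ledger-diagonal : ∀ {x y h ℓ c P} → Ledger x y h ℓ c P → y ≤ x
ledger-diagonal {y = y} {h} {P = P} L = ≤-trans (m≤n+m y (length P + h)) (≤-reflexive (Ledger.balance L))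

ledger-output : ∀ {x y h ℓ c P} → Ledger x y h ℓ c P → ℓ ≤ y
ledger-output {ℓ = ℓ} {c} {P} L = ≤-trans (m≤n+m ℓ (sum P + c)) (≤-reflexive (Ledger.count L))

ledger-E : ∀ {x y h ℓ c P} → Ledger x y h ℓ c P → Ledger (suc x) y (suc h) ℓ c P
ledger-E {y = y} {h} {P = P} L = record
  { positive = Ledger.positive L
  ; balance  = trans (cong (_+ y) (+-suc (length P) h)) (cong suc (Ledger.balance L))
  ; count    = Ledger.count L }

-- After an up-step the ledger is over-full by one: an N of the word or the
-- start of a block will restore it.
ledger-N : ∀ {x y h ℓ c P} → Ledger x y h ℓ c P → Ledger (suc x) (suc y) h ℓ (suc c) P
ledger-N {y = y} {h} {ℓ} {c} {P} L = record
  { positive = Ledger.positive L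
  ; balance  = trans (+-suc (length P + h) y) (cong suc (Ledger.balance L))
  ; count    = trans (cong (_+ ℓ) (+-suc (sum P) c)) (cong suc (Ledger.count L)) }

ledger-D : ∀ {x y h ℓ c P} → Ledger x y h ℓ c P → Ledger (suc (suc x)) (suc y) h ℓ 0 (P ++ [ suc c ])
ledger-D {y = y} {h} {ℓ} {c} {P} L = record
  { positive = ++⁺ (Ledger.positive L) (s≤s z≤n ∷ [])
  ; balance  = trans (cong (λ z → z + h + suc y) (length-++ P))
                     (trans (shift₁ (length P) h y) (cong (λ z → suc (suc z)) (Ledger.balance L)))
  ; count    = trans (cong (λ z → z + 0 + ℓ) (sum-++ P [ suc c ]))
                     (trans (shift₂ (sum P) c ℓ) (cong suc (Ledger.count L))) }
  where
  shift₁ : ∀ a h y → a + 1 + h + suc y ≡ suc (suc (a + h + y))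
  shift₁ = solve-∀
  shift₂ : ∀ s c ℓ → s + (suc c + 0) + 0 + ℓ ≡ suc (s + c + ℓ)
  shift₂ = solve-∀

ledger-pop : ∀ {x y ℓ c t P} → Ledger (suc x) y 0 ℓ c (suc t ∷ P) → Ledger x y 0 (ℓ + suc t) c P
ledger-pop {ℓ = ℓ} {c} {t} {P} L = record
  { positive = All.tail (Ledger.positive L)
  ; balance  = suc-injective (Ledger.balance L)
  ; count    = trans (rearrange (sum P) c ℓ t) (Ledger.count L) }
  where
  rearrange : ∀ s c ℓ t → s + c + (ℓ + suc t) ≡ suc t + s + c + ℓ
  rearrange = solve-∀

ledger-lower : ∀ {x y h ℓ c P} → Ledger (suc x) y (suc h) ℓ c P → Ledger x y h ℓ c P
ledger-lower {y = y} {h} {P = P} L = record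
  { positive = Ledger.positive L
  ; balance  = suc-injective (trans (sym (cong (_+ y) (+-suc (length P) h))) (Ledger.balance L))
  ; count    = Ledger.count L }

pending-after-D : ∀ P c → suc (sum P + c) ≡ sum (P ++ [ suc c ]) + 0
pending-after-D P c = sym (trans (cong (_+ 0) (sum-++ P [ suc c ])) (collect (sum P) c))
  where
  collect : ∀ s c → s + (suc c + 0) + 0 ≡ suc (s + c)
  collect = solve-∀

height-bound : ∀ {m x y S} → Schröder m x y S → y ≤ m
height-bound done         = ≤-refl
height-bound (stepE S)    = height-bound S
height-bound (stepN _ S)  = <⇒≤ (height-bound S)
height-bound (stepD S)    = <⇒≤ (height-bound S)

module Construction (m : ℕ) where

  Continuation : ℕ → ℕ → ℕ → List Letter → Set
  Continuation x y c U =
    ∀ {h ℓ P} → Ledger x y h ℓ c P → Built (suc m) ℓ h (sum P + c) (P ++ prescribed c U) U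

  -- An up-step l arriving at (x , y), recorded in an over-full ledger: the word
  -- gets an N if the first stack is nonempty, and otherwise the block of the
  -- oldest pending D (there is one, as the path stays below the diagonal).
  climb : ∀ {l U x y h ℓ c P σ q} → Up l → y ≤ x → y ≤ suc m → Ledger (suc x) y h ℓ c P →
          suc σ ≡ sum P + c → q ≡ P ++ prescribed c U → Continuation x y c U → Built (suc m) ℓ h σ q (l ∷ U)
  climb {h = suc h} {ℓ} {σ = σ} up _ y≤n L σ≡ q≡ rest =
    extend-N up ℓ<n (recast (sym σ≡) (sym q≡) (rest (ledger-lower L)))
    where
    ℓ<n : ℓ < suc m
    ℓ<n = ≤-trans (s≤s (m≤n+m ℓ σ)) (≤-trans (≤-reflexive (trans (cong (_+ ℓ) σ≡) (Ledger.count L))) y≤n)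
  climb {x = x} {h = zero} {P = []}    up y≤x _ L _ _ _ = ⊥-elim (n≮n x (subst (_≤ x) (Ledger.balance L) y≤x))
  climb {h = zero} {P = zero ∷ _}      up _   _ L _ _ _ = ⊥-elim (n≮n 0 (All.head (Ledger.positive L)))
  climb {h = zero} {ℓ} {c} {suc t ∷ P} {σ} up _ y≤n L σ≡ q≡ rest =
    recast σ≡' (sym q≡) (extend-block up (≤-trans (ledger-output (ledger-pop L)) y≤n) (rest (ledger-pop L)))
    where
    σ≡' : t + (sum P + c) ≡ σ
    σ≡' = trans (sym (+-assoc t (sum P) c)) (sym (suc-injective σ≡))

  -- At height m+1 the ledger balance leaves no room for pending entries.
  overfull : ∀ a → suc a + suc m ≢ suc m
  overfull a e = <-irrefl (sym e) (s≤s (m≤n+m (suc m) a))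

  corner : Continuation (suc m) (suc m) 0 []
  corner {zero}  {P = []}    L with Ledger.count L
  ... | refl = terminal
  corner {suc h} {P = []}    L = ⊥-elim (overfull h (Ledger.balance L))
  corner {h}     {P = _ ∷ P} L = ⊥-elim (overfull (length P + h) (Ledger.balance L))


  build : ∀ {x y h ℓ c P} S → Schröder m x y S → Ledger x y h ℓ c P →
          Built (suc m) ℓ h (sum P + c) (P ++ prescribed c (S ++ [ D ])) (S ++ [ D ])
  build {c = c} {P} [] done L =
    climb up-D ≤-refl ≤-refl (ledger-D L) (pending-after-D P c) (sym (++-assoc P [ suc c ] [])) corner
  build (E ∷ S) (stepE path) L =
    extend-E (s≤s (≤-trans (ledger-output L) (height-bound path))) (build S path (ledger-E L))
  build (N ∷ S) (stepN y<x path) L =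
    climb up-N y<x (m≤n⇒m≤1+n (height-bound path)) (ledger-N L) (sym (+-suc _ _)) refl (build S path)
  build {c = c} {P} (D ∷ S) (stepD path) L =
    climb up-D (s≤s (ledger-diagonal L)) (m≤n⇒m≤1+n (height-bound path)) (ledger-D L)
      (pending-after-D P c) (sym (++-assoc P [ suc c ] (prescribed 0 (S ++ [ D ])))) (build S path)

lemma3p6 : (n : ℕ) → 0 < n → (S : List Letter) → SchröderPath (n ∸ 1) S →
    Σ (List ℕ) λ π → π ↭ oneTo n × DISortable n π ×
      Σ (List Letter) λ W → ADIWord n π W × Φ W ≡ S
lemma3p6 (suc m) _ S path with Construction.build m S path start
... | record { stack₁ = _ ∷ _ ; height = () }
... | record { stack₁ = [] ; stack₂ = _ ∷ _ ; depth = () }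
... | record { tokens = ts ; queue = π ; stack₁ = [] ; stack₂ = [] ; skeleton≡ = skel ; lengths≡ = lens ; finishes = run } =
  π , sorted-permutation exec , (flatten ts , final (suc m) , exec , sym (oneTo≡interval (suc m))) ,
  flatten ts , adi , Φ-recovers S ts skel lens
  where open ADITail run
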